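{- Let $U$ be a $\lambda H$-term and $I=\lambda x\,x$. Then $U$ is $I$-$t$-solvable if and only if the $\lambda$-term $U[I/H]$ is solvable.
   Context: $\lambda H$-terms are the $\lambda$-terms built from variables and one additional constant $H$ by abstraction and application; $U[I/H]$ is the result of replacing every occurrence of $H$ by $I$. Application is left-associative. The head reduction step $\rightarrow_t$ is $\lambda\overline{x}\,((\lambda x\,A)\,B)\,W_1\ldots W_n\rightarrow_t\lambda\overline{x}\,A[B/x]\,W_1\ldots W_n$. The $I$-reduction is $\lambda\overline{x}\,H\,U_1\ldots U_n\rightarrow_I\lambda\overline{x}\,U_1U_2\ldots U_n$ for $n\ge1$. A $\lambda H$-term is in head normal form if it has the form $\lambda\overline{x}\,H$ or $\lambda\overline{x}\,x\,V_1\ldots V_n$ with $x$ a variable. A $\lambda H$-term is $I$-$t$-solvable iff some finite sequence of $I$-reduction steps and $t$-reduction steps from it yields a head normal form. A $\lambda$-term is solvable iff its head reduction terminates (reaches a term $\lambda\overline{x}\,x\,V_1\ldots V_n$). -}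

module Defs where

open import Data.Nat using (ℕ; zero; suc)
open import Relation.Binary.Construct.Closure.ReflexiveTransitive using (Star)

data Term : Set where
  var : ℕ → Term
  H   : Term
  lam : Term → Term
  app : Term → Term → Term

ext : (ℕ → ℕ) → ℕ → ℕ
ext ρ zero    = zero
ext ρ (suc n) = suc (ρ n)

rename : (ℕ → ℕ) → Term → Term
rename ρ (var n)   = var (ρ n)
rename ρ H         = H
rename ρ (lam M)   = lam (rename (ext ρ) M)
rename ρ (app M N) = app (rename ρ M) (rename ρ N)

exts : (ℕ → Term) → ℕ → Term
exts σ zero    = var zero
exts σ (suc n) = rename suc (σ n)

subst : (ℕ → Term) → Term → Term
subst σ (var n)   = σ n
subst σ H         = H
subst σ (lam M)   = lam (subst (exts σ) M)
subst σ (app M N) = app (subst σ M) (subst σ N)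

single : Term → ℕ → Term
single B zero    = B
single B (suc n) = var n

_[_] : Term → Term → Term
A [ B ] = subst (single B) A

I : Term
I = lam (var zero)

_[I/H] : Term → Term
var n [I/H]   = var n
H [I/H]       = I
lam M [I/H]   = lam (M [I/H])
app M N [I/H] = app (M [I/H]) (N [I/H])

-- Head reduction  λx̄ ((λx A) B) W₁…Wₙ →t λx̄ A[B/x] W₁…Wₙ.
-- _→ta_ acts on the body (after the prefix λx̄), _→t_ allows the λ-prefix.
data _→ta_ : Term → Term → Set where
  β    : ∀ {A B} → app (lam A) B →ta (A [ B ])
  appL : ∀ {M M' N} → M →ta M' → app M N →ta app M' N

data _→t_ : Term → Term → Set where
  body : ∀ {M M'} → M →ta M' → M →t M'
  lamt : ∀ {M M'} → M →t M' → lam M →t lam M'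

data _→Ia_ : Term → Term → Set where
  hd   : ∀ {U} → app H U →Ia U
  appL : ∀ {M M' N} → M →Ia M' → app M N →Ia app M' N

data _→I_ : Term → Term → Set where
  body : ∀ {M M'} → M →Ia M' → M →I M'
  lamI : ∀ {M M'} → M →I M' → lam M →I lam M'

data _→It_ : Term → Term → Set where
  Istep : ∀ {M M'} → M →I M' → M →It M'
  tstep : ∀ {M M'} → M →t M' → M →It M'

data VarHead : Term → Set where
  var : ∀ n → VarHead (var n)
  app : ∀ {M V} → VarHead M → VarHead (app M V)

data VarHNF : Term → Set where
  body : ∀ {M} → VarHead M → VarHNF M
  lam  : ∀ {M} → VarHNF M → VarHNF (lam M)

data HNF : Term → Set where
  bodyH : HNF H
  bodyV : ∀ {M} → VarHead M → HNF M
  lam   : ∀ {M} → HNF M → HNF (lam M)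

ItSolvable : Term → Set
ItSolvable U = ∃HNF
  where
  open import Data.Product using (Σ; _×_)
  ∃HNF = Σ Term (λ V → Star _→It_ U V × HNF V)

Solvable : Term → Set
Solvable M = ∃VarHNF
  where
  open import Data.Product using (Σ; _×_)
  ∃VarHNF = Σ Term (λ V → Star _→t_ M V × VarHNF V)

-- Erasing H to I turns an I-step  λx̄ H U₁…Uₙ → λx̄ U₁…Uₙ  into the head β-step
-- λx̄ I U₁…Uₙ → λx̄ U₁…Uₙ, turns a t-step into a t-step, and turns the head normal
-- form λx̄ H into λx̄ λx x; this gives the forward direction.  Conversely, a λH-term
-- that is not in head normal form always has an I- or t-step, whose erasure is then
-- the unique head step of the erased term, because head reduction is deterministic.
-- So a head reduction of U[I/H] to a head normal form can be reflected step by step.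
module Submission where

open import Defs
open import Data.Product using (_×_; _,_; Σ)
open import Data.Sum using (_⊎_; inj₁; inj₂)
open import Data.Nat using (zero; suc)
open import Data.Empty using (⊥-elim)
open import Relation.Nullary using (¬_)
open import Relation.Binary.PropositionalEquality
  using (_≡_; refl; sym; trans; cong; cong₂) renaming (subst to transport)
open import Relation.Binary.Construct.Closure.ReflexiveTransitive using (Star; ε; _◅_; gmap)

rename-[I/H] : ∀ ρ M → rename ρ M [I/H] ≡ rename ρ (M [I/H])
rename-[I/H] ρ (var n)   = refl
rename-[I/H] ρ H         = refl
rename-[I/H] ρ (lam M)   = cong lam (rename-[I/H] (ext ρ) M)
rename-[I/H] ρ (app M N) = cong₂ app (rename-[I/H] ρ M) (rename-[I/H] ρ N)

subst-[I/H] : ∀ σ τ → (∀ n → σ n [I/H] ≡ τ n) → ∀ M → subst σ M [I/H] ≡ subst τ (M [I/H])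
subst-[I/H] σ τ σ≗τ (var n)   = σ≗τ n
subst-[I/H] σ τ σ≗τ H         = refl
subst-[I/H] σ τ σ≗τ (lam M)   = cong lam (subst-[I/H] (exts σ) (exts τ) exts-σ≗τ M)
  where
  exts-σ≗τ : ∀ n → exts σ n [I/H] ≡ exts τ n
  exts-σ≗τ zero    = refl
  exts-σ≗τ (suc n) = trans (rename-[I/H] suc (σ n)) (cong (rename suc) (σ≗τ n))
subst-[I/H] σ τ σ≗τ (app M N) = cong₂ app (subst-[I/H] σ τ σ≗τ M) (subst-[I/H] σ τ σ≗τ N)

[]-[I/H] : ∀ A B → (A [ B ]) [I/H] ≡ (A [I/H]) [ B [I/H] ]
[]-[I/H] A B = subst-[I/H] (single B) (single (B [I/H])) single-[I/H] A
  where
  single-[I/H] : ∀ n → single B n [I/H] ≡ single (B [I/H]) n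
  single-[I/H] zero    = refl
  single-[I/H] (suc n) = refl

→Ia⇒→ta-[I/H] : ∀ {M M'} → M →Ia M' → (M [I/H]) →ta (M' [I/H])
→Ia⇒→ta-[I/H] hd       = β
→Ia⇒→ta-[I/H] (appL s) = appL (→Ia⇒→ta-[I/H] s)

→ta-[I/H] : ∀ {M M'} → M →ta M' → (M [I/H]) →ta (M' [I/H])
→ta-[I/H] (β {A} {B}) = transport (app (lam (A [I/H])) (B [I/H]) →ta_) (sym ([]-[I/H] A B)) β
→ta-[I/H] (appL s) = appL (→ta-[I/H] s)

→It⇒→t-[I/H] : ∀ {M M'} → M →It M' → (M [I/H]) →t (M' [I/H])
→It⇒→t-[I/H] (Istep s) = I-case s
  where
  I-case : ∀ {M M'} → M →I M' → (M [I/H]) →t (M' [I/H])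
  I-case (body s) = body (→Ia⇒→ta-[I/H] s)
  I-case (lamI s) = lamt (I-case s)
→It⇒→t-[I/H] (tstep s) = t-case s
  where
  t-case : ∀ {M M'} → M →t M' → (M [I/H]) →t (M' [I/H])
  t-case (body s) = body (→ta-[I/H] s)
  t-case (lamt s) = lamt (t-case s)

VarHead-[I/H] : ∀ {M} → VarHead M → VarHead (M [I/H])
VarHead-[I/H] (var n) = var n
VarHead-[I/H] (app h) = app (VarHead-[I/H] h)

HNF⇒VarHNF-[I/H] : ∀ {M} → HNF M → VarHNF (M [I/H])
HNF⇒VarHNF-[I/H] bodyH     = lam (body (var zero))
HNF⇒VarHNF-[I/H] (bodyV h) = body (VarHead-[I/H] h)
HNF⇒VarHNF-[I/H] (lam h)   = lam (HNF⇒VarHNF-[I/H] h)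

ItSolvable⇒Solvable-[I/H] : ∀ U → ItSolvable U → Solvable (U [I/H])
ItSolvable⇒Solvable-[I/H] U (V , steps , hnf) =
  V [I/H] , gmap _[I/H] →It⇒→t-[I/H] steps , HNF⇒VarHNF-[I/H] hnf

HNF⊎→It : ∀ M → HNF M ⊎ Σ Term (M →It_)
HNF⊎→It (var n) = inj₁ (bodyV (var n))
HNF⊎→It H       = inj₁ bodyH
HNF⊎→It (lam M) with HNF⊎→It M
... | inj₁ h              = inj₁ (lam h)
... | inj₂ (M' , Istep s) = inj₂ (lam M' , Istep (lamI s))
... | inj₂ (M' , tstep s) = inj₂ (lam M' , tstep (lamt s))
HNF⊎→It (app (var n) N)     = inj₁ (bodyV (app (var n)))
HNF⊎→It (app H N)           = inj₂ (N , Istep (body hd))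
HNF⊎→It (app (lam A) N)     = inj₂ (A [ N ] , tstep (body β))
HNF⊎→It (app (app M₁ M₂) N) with HNF⊎→It (app M₁ M₂)
... | inj₁ (bodyV h)             = inj₁ (bodyV (app h))
... | inj₂ (M' , Istep (body s)) = inj₂ (app M' N , Istep (body (appL s)))
... | inj₂ (M' , tstep (body s)) = inj₂ (app M' N , tstep (body (appL s)))

→ta-deterministic : ∀ {M A B} → M →ta A → M →ta B → A ≡ B
→ta-deterministic β        β        = refl
→ta-deterministic β        (appL ())
→ta-deterministic (appL ()) β
→ta-deterministic (appL s) (appL r) = cong (λ X → app X _) (→ta-deterministic s r)

→t-deterministic : ∀ {M A B} → M →t A → M →t B → A ≡ B
→t-deterministic (body s) (body r) = →ta-deterministic s r
→t-deterministic (body ()) (lamt r)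
→t-deterministic (lamt s) (body ())
→t-deterministic (lamt s) (lamt r) = cong lam (→t-deterministic s r)

VarHead-→ta-normal : ∀ {M M'} → VarHead M → ¬ (M →ta M')
VarHead-→ta-normal (var n) ()
VarHead-→ta-normal (app ()) β
VarHead-→ta-normal (app h) (appL s) = VarHead-→ta-normal h s

VarHNF-→t-normal : ∀ {M M'} → VarHNF M → ¬ (M →t M')
VarHNF-→t-normal (body h) (body s) = VarHead-→ta-normal h s
VarHNF-→t-normal (body ()) (lamt s)
VarHNF-→t-normal (lam h) (body ())
VarHNF-→t-normal (lam h) (lamt s) = VarHNF-→t-normal h s

ItSolvable-◅ : ∀ {M M'} → M →It M' → ItSolvable M' → ItSolvable M
ItSolvable-◅ s (V , steps , hnf) = V , s ◅ steps , hnf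

-- The equation W ≡ U [I/H] keeps the index of the reduction a variable, so that
-- induction on the reduction is possible.
Solvable⇒ItSolvable-[I/H] : ∀ U {W V} → Star _→t_ W V → W ≡ U [I/H] → VarHNF V → ItSolvable U
Solvable⇒ItSolvable-[I/H] U steps eq v with HNF⊎→It U
... | inj₁ hnf = U , ε , hnf
Solvable⇒ItSolvable-[I/H] U ε refl v | inj₂ (U' , s) =
  ⊥-elim (VarHNF-→t-normal v (→It⇒→t-[I/H] s))
Solvable⇒ItSolvable-[I/H] U (r ◅ rs) refl v | inj₂ (U' , s) =
  ItSolvable-◅ s (Solvable⇒ItSolvable-[I/H] U' rs (→t-deterministic r (→It⇒→t-[I/H] s)) v)

lemma3p9 : (U : Term) → (ItSolvable U → Solvable (U [I/H])) × (Solvable (U [I/H]) → ItSolvable U)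
lemma3p9 U = ItSolvable⇒Solvable-[I/H] U
           , λ { (V , steps , v) → Solvable⇒ItSolvable-[I/H] U steps refl v }
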